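{- Let $\mathbf{L}\in\{\mathbf{K},\mathbf{T},\mathbf{K4},\mathbf{S4}\}$ and let $\varphi$ be an $\mathbf{L}^{Horn,\Box}$-formula. Then $\varphi$ is $\mathbf{L}$-satisfiable if and only if it is satisfiable in a pre-linear model of the corresponding type, namely a pre-linear model for $\mathbf{K}$, a pre-linear reflexive model for $\mathbf{T}$, a pre-linear transitive model for $\mathbf{K4}$, and a pre-linear reflexive and transitive model for $\mathbf{S4}$.
   Context: Fix a countable set $\mathcal P$ of propositional letters; Kripke models $((W,R),V)$ with $V:W\to2^{\mathcal P}$ and standard modal satisfaction. $\mathbf{K},\mathbf{T},\mathbf{K4},\mathbf{S4}$ are interpreted over all, reflexive, transitive, and reflexive-transitive frames respectively; $\varphi$ is $\mathbf{L}$-satisfiable if it holds at some world of some model over a frame in the class of $\mathbf{L}$. Box positive literals: $\lambda::=\top\mid p\mid\Box\lambda$. An $\mathbf{L}^{Horn,\Box}$-formula is a finite conjunction of clauses $\Box^s(\neg\lambda_1\vee\dots\vee\neg\lambda_n\vee\lambda_{n+1}\vee\dots\vee\lambda_{n+m})$ with $s,n\ge0$, $m\le1$, $\lambda_i$ box positive literals. A frame $(W,R)$ is pre-linear if there is a unique world $w_0$ (root) with $w_0R^*w$ for all $w\in W$ ($R^*$ the reflexive-transitive closure) and every world has at most one $R$-successor; a pre-linear model is a model on such a frame. Pre-linear reflexive (resp. transitive, reflexive and transitive) models are obtained from pre-linear models by replacing $R$ with its reflexive closure (resp. transitive closure, reflexive-transitive closure). -}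

module Defs where

open import Data.Nat using (ℕ; zero; suc)
open import Data.List using (List; []; _∷_)
open import Data.Maybe using (Maybe; just; nothing)
open import Data.Product using (Σ; _×_; _,_; ∃)
open import Data.Sum using (_⊎_)
open import Data.Unit using (⊤)
open import Data.Empty using (⊥)
open import Relation.Nullary using (¬_)
open import Relation.Binary.PropositionalEquality using (_≡_)
open import Relation.Binary.Construct.Closure.Reflexive using (ReflClosure)
open import Relation.Binary.Construct.Closure.Transitive using (TransClosure)
open import Relation.Binary.Construct.Closure.ReflexiveTransitive using (Star)

Letter : Set
Letter = ℕ

data Fm : Set where
  var  : Letter → Fm
  ⊤'   : Fm
  ⊥'   : Fm
  ¬'_  : Fm → Fm
  _∧'_ : Fm → Fm → Fm
  _∨'_ : Fm → Fm → Fm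
  □_   : Fm → Fm

record Frame : Set₁ where
  field
    W : Set
    R : W → W → Set
open Frame public

record Model : Set₁ where
  field
    frame : Frame
    V     : W frame → Letter → Set
open Model public

_,_⊨_ : (M : Model) → W (frame M) → Fm → Set
M , w ⊨ var p    = V M w p
M , w ⊨ ⊤'       = ⊤
M , w ⊨ ⊥'       = ⊥
M , w ⊨ (¬' φ)   = ¬ (M , w ⊨ φ)
M , w ⊨ (φ ∧' ψ) = (M , w ⊨ φ) × (M , w ⊨ ψ)
M , w ⊨ (φ ∨' ψ) = (M , w ⊨ φ) ⊎ (M , w ⊨ ψ)
M , w ⊨ (□ φ)    = ∀ v → R (frame M) w v → M , v ⊨ φ

data BoxLit : Set where
  top : BoxLit
  lit : Letter → BoxLit
  box : BoxLit → BoxLit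

-- clause □^s (¬λ₁ ∨ … ∨ ¬λₙ ∨ λₙ₊₁…) with m ≤ 1 positive literal
record Clause : Set where
  constructor clause
  field
    depth     : ℕ
    negatives : List BoxLit
    positive  : Maybe BoxLit

HornBox : Set
HornBox = List Clause

⌜_⌝ₗ : BoxLit → Fm
⌜ top ⌝ₗ   = ⊤'
⌜ lit p ⌝ₗ = var p
⌜ box l ⌝ₗ = □ ⌜ l ⌝ₗ

□^ : ℕ → Fm → Fm
□^ zero    φ = φ
□^ (suc s) φ = □ (□^ s φ)

body : List BoxLit → Maybe BoxLit → Fm
body []       nothing  = ⊥'
body []       (just l) = ⌜ l ⌝ₗ
body (l ∷ ls) pos      = (¬' ⌜ l ⌝ₗ) ∨' body ls pos

⌜_⌝c : Clause → Fm
⌜ clause s neg pos ⌝c = □^ s (body neg pos)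

⌜_⌝ : HornBox → Fm
⌜ [] ⌝     = ⊤'
⌜ c ∷ cs ⌝ = ⌜ c ⌝c ∧' ⌜ cs ⌝

data Logic : Set where
  K T K4 S4 : Logic

IsReflexive : (F : Frame) → Set
IsReflexive F = ∀ w → R F w w

IsTransitive : (F : Frame) → Set
IsTransitive F = ∀ u v w → R F u v → R F v w → R F u w

InClass : Logic → Frame → Set
InClass K  F = ⊤
InClass T  F = IsReflexive F
InClass K4 F = IsTransitive F
InClass S4 F = IsReflexive F × IsTransitive F

Satisfiable : Logic → Fm → Set₁
Satisfiable L φ =
  Σ Model λ M → InClass L (frame M) × Σ (W (frame M)) λ w → M , w ⊨ φ

IsRoot : (F : Frame) → W F → Set
IsRoot F w₀ = ∀ w → Star (R F) w₀ w

IsPreLinear : Frame → Set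
IsPreLinear F =
  (Σ (W F) λ w₀ → IsRoot F w₀ × (∀ w₁ → IsRoot F w₁ → w₁ ≡ w₀))
  × (∀ w u v → R F w u → R F w v → u ≡ v)

-- the relation of the pre-linear model of the type corresponding to L
closeFor : Logic → (F : Frame) → W F → W F → Set
closeFor K  F = R F
closeFor T  F = ReflClosure (R F)
closeFor K4 F = TransClosure (R F)
closeFor S4 F = Star (R F)

closeModel : Logic → Model → Model
closeModel L M = record
  { frame = record { W = W (frame M) ; R = closeFor L (frame M) }
  ; V     = V M }

PreLinearSatisfiable : Logic → Fm → Set₁
PreLinearSatisfiable L φ =
  Σ Model λ M → IsPreLinear (frame M) ×
    Σ (W (frame M)) λ w → closeModel L M , w ⊨ φ

-- Fix a world w of an L-model satisfying φ. The chain 0 → 1 → ⋯ → C whose node i makes a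
-- letter p true iff □ⁱ p holds at w, possibly closed by a loop at C, evaluates every box literal
-- λ at node i as □ⁱ λ is evaluated at w (as long as the depths involved fit in the chain), and
-- □ʲ distributes over modus ponens, so each Horn clause □ˢ(¬λ₁ ∨ ⋯ ∨ ¬λₙ ∨ λ) true at w stays
-- true at the root. The length and loop depend on L: for K the chain stops at the first depth
-- C with □ᶜ⁺¹⊥ true at w, or loops once it exceeds the modal depth; for T it is as long as the
-- modal depth; for S4 a single step suffices; for K4 it loops at a depth from which all
-- relevant □ⁱ p, which are monotone in i by transitivity, have stabilised.
--
-- The valuation of that chain is not computable from M, but among the finitely many chains of
-- bounded length over the relevant letters the existence of a model of φ is decidable, so it
-- suffices to refute its absence, and inside a double negation excluded middle is available.
module Submission where

open import Defs
open import Function.Base using (_∘_)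
open import Function.Bundles using (_⇔_; mk⇔; Equivalence)
open import Data.Nat using (ℕ; zero; suc; _+_; _∸_; _⊔_; _≤_; _<_; z≤n; s≤s; _≟_; _≤?_; _<?_)
open import Data.Nat.Properties
open import Data.Bool using (Bool; true; false) renaming (T to IsTrue)
import Data.Fin as Fin
open import Data.Fin using (Fin; toℕ; fromℕ<; fromℕ) renaming (zero to fzero; suc to fsuc)
open import Data.Fin.Properties using (toℕ<n; toℕ-fromℕ<; toℕ-injective; toℕ-fromℕ; all?)
open import Data.Vec using (Vec; []; _∷_; lookup)
open import Data.List using ([]; _∷_)
open import Data.List.Relation.Unary.All as All using (All; []; _∷_)
open import Data.Maybe using (just; nothing)
open import Data.Maybe.Relation.Unary.All as MaybeAll using (just; nothing)
open import Data.Product using (Σ; ∃; _×_; _,_)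
open import Data.Sum using (_⊎_; inj₁; inj₂; [_,_])
open import Data.Unit using (⊤; tt)
open import Data.Empty using (⊥; ⊥-elim)
open import Level using (0ℓ)
open import Effect.Monad using (RawMonad)
open import Relation.Nullary using (¬_; Dec; yes; no)
open import Relation.Nullary.Negation using (¬¬-Monad; DoubleNegation)
open import Relation.Nullary.Decidable
  using (map′; _×-dec_; _⊎-dec_; _→-dec_; ¬?; isYes; decidable-stable; ¬¬-excluded-middle; toWitness; fromWitness)
  renaming (T? to IsTrue?)
open import Relation.Binary.PropositionalEquality using (_≡_; refl; sym; trans; cong; subst)
import Relation.Binary.Construct.Closure.Reflexive as Refl
import Relation.Binary.Construct.Closure.Transitive as Trans
open import Relation.Binary.Construct.Closure.ReflexiveTransitive using (Star; ε; _◅_; _◅◅_)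

open Equivalence using (to; from)
open RawMonad (¬¬-Monad {0ℓ}) using (pure; _>>=_)

□^-+ : ∀ a b φ → □^ a (□^ b φ) ≡ □^ (a + b) φ
□^-+ zero    b φ = refl
□^-+ (suc a) b φ = cong □_ (□^-+ a b φ)

□^-suc : ∀ a φ → □^ a (□ φ) ≡ □^ (suc a) φ
□^-suc zero    φ = refl
□^-suc (suc a) φ = cong □_ (□^-suc a φ)

boxes : BoxLit → ℕ
boxes top     = 0
boxes (lit p) = 0
boxes (box l) = suc (boxes l)

core : BoxLit → Fm
core top     = ⊤'
core (lit p) = var p
core (box l) = core l

⌜⌝ₗ-normal : ∀ l → ⌜ l ⌝ₗ ≡ □^ (boxes l) (core l)
⌜⌝ₗ-normal top     = refl
⌜⌝ₗ-normal (lit p) = refl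
⌜⌝ₗ-normal (box l) = cong □_ (⌜⌝ₗ-normal l)

module Boxes (M : Model) where

  ⊨-≡ : ∀ {w φ ψ} → φ ≡ ψ → M , w ⊨ φ → M , w ⊨ ψ
  ⊨-≡ {w} = subst (M , w ⊨_)

  ⊨□^-≡ : ∀ {w a b} φ → a ≡ b → M , w ⊨ □^ a φ → M , w ⊨ □^ b φ
  ⊨□^-≡ {w} φ = subst (λ n → M , w ⊨ □^ n φ)

  □^-fold : ∀ {w} m ψ → M , w ⊨ □^ m (□ ψ) → M , w ⊨ □^ (suc m) ψ
  □^-fold m ψ = ⊨-≡ (□^-suc m ψ)

  □^-unfold : ∀ {w} m ψ → M , w ⊨ □^ (suc m) ψ → M , w ⊨ □^ m (□ ψ)
  □^-unfold m ψ = ⊨-≡ (sym (□^-suc m ψ))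

  □^-mono : ∀ j {φ ψ} → (∀ v → M , v ⊨ φ → M , v ⊨ ψ) → ∀ w → M , w ⊨ □^ j φ → M , w ⊨ □^ j ψ
  □^-mono zero    f w h = f w h
  □^-mono (suc j) f w h v r = □^-mono j f v (h v r)

  □^-zip : ∀ j {φ ψ χ} → (∀ v → M , v ⊨ φ → M , v ⊨ ψ → M , v ⊨ χ) →
    ∀ w → M , w ⊨ □^ j φ → M , w ⊨ □^ j ψ → M , w ⊨ □^ j χ
  □^-zip zero    f w h g = f w h g
  □^-zip (suc j) f w h g v r = □^-zip j f v (h v r) (g v r)

  □^-⊤ : ∀ j w → M , w ⊨ □^ j ⊤'
  □^-⊤ zero    w = tt
  □^-⊤ (suc j) w v r = □^-⊤ j v

  □^-⊥-≤ : ∀ {j k} φ w → j ≤ k → M , w ⊨ □^ j ⊥' → M , w ⊨ □^ k φ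
  □^-⊥-≤ {j} {k} φ w j≤k h =
    ⊨□^-≡ φ (trans (+-comm j (k ∸ j)) (m∸n+n≡m j≤k))
      (⊨-≡ (□^-+ j (k ∸ j) φ) (□^-mono j (λ v ()) w h))

  module _ (reflexive : IsReflexive (frame M)) where

    □^-drop : ∀ c {ψ} w → M , w ⊨ □^ c ψ → M , w ⊨ ψ
    □^-drop zero    w h = h
    □^-drop (suc c) w h = □^-drop c w (h w (reflexive w))

    □^-antitone : ∀ {k j} φ w → k ≤ j → M , w ⊨ □^ j φ → M , w ⊨ □^ k φ
    □^-antitone {k} {j} φ w k≤j h =
      □^-drop (j ∸ k) w (⊨-≡ (sym (□^-+ (j ∸ k) k φ)) (⊨□^-≡ φ (sym (m∸n+n≡m k≤j)) h))

    ¬□^⊥ : ∀ j w → ¬ (M , w ⊨ □^ j ⊥')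
    ¬□^⊥ j w = □^-antitone {0} {j} ⊥' w z≤n

  module _ (transitive : IsTransitive (frame M)) where

    □-four : ∀ c {ψ} w → M , w ⊨ (□ ψ) → M , w ⊨ □^ (suc c) ψ
    □-four zero    w h = h
    □-four (suc c) w h v r = □-four c v (λ u r′ → h u (transitive w v u r r′))

    □^-monotone : ∀ {a b} φ w → 1 ≤ a → a ≤ b → M , w ⊨ □^ a φ → M , w ⊨ □^ b φ
    □^-monotone {suc a} {b} φ w _ a<b h =
      ⊨□^-≡ φ (trans (sym (+-suc (b ∸ suc a) a)) (m∸n+n≡m a<b))
        (⊨-≡ (□^-+ (suc (b ∸ suc a)) a φ) (□-four (b ∸ suc a) w h))

  module _ (reflexive : IsReflexive (frame M)) (transitive : IsTransitive (frame M)) where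

    □^-from-positive : ∀ {a b} φ w → 1 ≤ a → M , w ⊨ □^ a φ → M , w ⊨ □^ b φ
    □^-from-positive {a} {b} φ w 1≤a h with b ≤? a
    ... | yes b≤a = □^-antitone reflexive φ w b≤a h
    ... | no  b≰a = □^-monotone transitive φ w 1≤a (<⇒≤ (≰⇒> b≰a)) h

-- □ʲ distributes over modus ponens but not over disjunction: hence at most one positive literal.
horn-transfer : ∀ {M N : Model} (Q : BoxLit → Set) {x : W (frame N)} {w : W (frame M)} j ls pos →
  All Q ls → MaybeAll.All Q pos →
  (∀ l → Dec (N , x ⊨ ⌜ l ⌝ₗ)) →
  (∀ l → Q l → N , x ⊨ ⌜ l ⌝ₗ ⇔ M , w ⊨ □^ j ⌜ l ⌝ₗ) →
  ¬ (M , w ⊨ □^ j ⊥') →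
  M , w ⊨ □^ j (body ls pos) → N , x ⊨ body ls pos
horn-transfer Q j []       nothing  []       nothing  _ _     ¬⊥ h = ¬⊥ h
horn-transfer Q j []       (just l) []       (just q) _ agree ¬⊥ h = from (agree l q) h
horn-transfer {M} Q {w = w} j (l ∷ ls) pos (q ∷ qs) qpos dec agree ¬⊥ h with dec l
... | no ¬l = inj₁ ¬l
... | yes l⊨ = inj₂ (horn-transfer Q j ls pos qs qpos dec agree ¬⊥
                      (Boxes.□^-zip M j (λ _ → modus-ponens) w h (to (agree l q) l⊨)))
  where
  modus-ponens : ∀ {A B : Set} → (¬ A) ⊎ B → A → B
  modus-ponens (inj₁ ¬a) a = ⊥-elim (¬a a)
  modus-ponens (inj₂ b)  _ = b

□^-intro : (N : Model) (Inv : W (frame N) → ℕ → Set) {ψ : Fm} →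
  (∀ a → Inv a 0 → N , a ⊨ ψ) →
  (∀ {a r v} → Inv a (suc r) → R (frame N) a v → Inv v r) →
  ∀ r a → Inv a r → N , a ⊨ □^ r ψ
□^-intro N Inv base step zero    a i = base a i
□^-intro N Inv base step (suc r) a i v a→v = □^-intro N Inv base step r v (step i a→v)

LettersBelow : ℕ → BoxLit → Set
LettersBelow n top     = ⊤
LettersBelow n (lit p) = p < n
LettersBelow n (box l) = LettersBelow n l

LiteralBounded : ℕ → ℕ → BoxLit → Set
LiteralBounded s n l = s + boxes l ≤ n × LettersBelow n l

ClauseBounded : ℕ → Clause → Set
ClauseBounded n (clause s ls pos) =
  s ≤ n × All (LiteralBounded s n) ls × MaybeAll.All (LiteralBounded s n) pos

Bounded : ℕ → HornBox → Set
Bounded n = All (ClauseBounded n)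

LettersBelow-mono : ∀ {m n} → m ≤ n → ∀ l → LettersBelow m l → LettersBelow n l
LettersBelow-mono m≤n top     _   = tt
LettersBelow-mono m≤n (lit p) p<m = ≤-trans p<m m≤n
LettersBelow-mono m≤n (box l) b   = LettersBelow-mono m≤n l b

LiteralBounded-mono : ∀ {s m n} → m ≤ n → ∀ l → LiteralBounded s m l → LiteralBounded s n l
LiteralBounded-mono m≤n l (d , b) = ≤-trans d m≤n , LettersBelow-mono m≤n l b

ClauseBounded-mono : ∀ {m n} → m ≤ n → ∀ c → ClauseBounded m c → ClauseBounded n c
ClauseBounded-mono m≤n (clause s ls pos) (s≤m , bls , bpos) =
  ≤-trans s≤m m≤n , All.map (λ {l} → LiteralBounded-mono m≤n l) bls , MaybeAll.map (λ {l} → LiteralBounded-mono m≤n l) bpos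

module _ {A : Set} (Q : ℕ → A → Set) (Q-mono : ∀ {m n} → m ≤ n → ∀ a → Q m a → Q n a) where

  common-bound : (∀ a → ∃ λ n → Q n a) → ∀ xs → ∃ λ n → All (Q n) xs
  common-bound bound []       = 0 , []
  common-bound bound (x ∷ xs) with bound x | common-bound bound xs
  ... | m , qx | n , qxs = m ⊔ n , Q-mono (m≤m⊔n m n) x qx ∷ All.map (λ {a} → Q-mono (m≤n⊔m m n) a) qxs

  common-bound-maybe : (∀ a → ∃ λ n → Q n a) → ∀ x → ∃ λ n → MaybeAll.All (Q n) x
  common-bound-maybe bound nothing  = 0 , nothing
  common-bound-maybe bound (just x) with bound x
  ... | n , qx = n , just qx

letters-bound : ∀ l → ∃ λ n → LettersBelow n l
letters-bound top     = 0 , tt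
letters-bound (lit p) = suc p , ≤-refl
letters-bound (box l) = letters-bound l

literal-bound : ∀ s l → ∃ λ n → LiteralBounded s n l
literal-bound s l with letters-bound l
... | n , b = s + boxes l ⊔ n , m≤m⊔n _ n , LettersBelow-mono (m≤n⊔m _ n) l b

clause-bound : ∀ c → ∃ λ n → ClauseBounded n c
clause-bound (clause s ls pos)
  with common-bound (LiteralBounded s) LiteralBounded-mono (literal-bound s) ls
     | common-bound-maybe (LiteralBounded s) LiteralBounded-mono (literal-bound s) pos
... | m , bls | n , bpos =
  s ⊔ (m ⊔ n) , m≤m⊔n s _ ,
  All.map (λ {l} → LiteralBounded-mono (≤-trans (m≤m⊔n m n) (m≤n⊔m s _)) l) bls ,
  MaybeAll.map (λ {l} → LiteralBounded-mono (≤-trans (m≤n⊔m m n) (m≤n⊔m s _)) l) bpos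

bounded : ∀ φ → ∃ λ n → Bounded n φ
bounded = common-bound ClauseBounded ClauseBounded-mono clause-bound

⌜⌝-transfer : ∀ {M N : Model} {w : W (frame M)} {x : W (frame N)} {n} →
  (∀ c → ClauseBounded n c → M , w ⊨ ⌜ c ⌝c → N , x ⊨ ⌜ c ⌝c) →
  ∀ φ → Bounded n φ → M , w ⊨ ⌜ φ ⌝ → N , x ⊨ ⌜ φ ⌝
⌜⌝-transfer transfer []       []       _        = tt
⌜⌝-transfer transfer (c ∷ cs) (b ∷ bs) (h , hs) = transfer c b h , ⌜⌝-transfer transfer cs bs hs

AtLoop : (C : ℕ) → Bool → Fin (suc C) → Fin (suc C) → Set
AtLoop C loop i j = IsTrue loop × toℕ i ≡ C × toℕ j ≡ C

Step : (C : ℕ) → Bool → Fin (suc C) → Fin (suc C) → Set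
Step C loop i j = toℕ j ≡ suc (toℕ i) ⊎ AtLoop C loop i j

lassoFrame : ℕ → Bool → Frame
lassoFrame C loop = record { W = Fin (suc C) ; R = Step C loop }

Table : ℕ → ℕ → Set
Table n C = Vec (Vec Bool n) (suc C)

-- Letters beyond the table are false.
bit : ∀ {n} → Vec Bool n → ℕ → Bool
bit []       _       = false
bit (b ∷ bs) zero    = b
bit (b ∷ bs) (suc p) = bit bs p

bit-toℕ : ∀ {n} (bs : Vec Bool n) (j : Fin n) → bit bs (toℕ j) ≡ lookup bs j
bit-toℕ (b ∷ bs) fzero    = refl
bit-toℕ (b ∷ bs) (fsuc j) = bit-toℕ bs j

lasso : ∀ {n C} → Bool → Table n C → Model
lasso {C = C} loop t = record { frame = lassoFrame C loop ; V = λ i p → IsTrue (bit (lookup t i) p) }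

module Lasso (C : ℕ) (loop : Bool) where

  Node : Set
  Node = Fin (suc C)

  toℕ≤C : (i : Node) → toℕ i ≤ C
  toℕ≤C i = ≤-pred (toℕ<n i)

  successor : (i : Node) → suc (toℕ i) ≤ C → Σ Node λ k → toℕ k ≡ suc (toℕ i)
  successor i i<C = fromℕ< (s≤s i<C) , toℕ-fromℕ< (s≤s i<C)

  no-successor-at-end : (i j : Node) → toℕ i ≡ C → toℕ j ≡ suc (toℕ i) → ⊥
  no-successor-at-end i j i≡C j≡1+i =
    <-irrefl refl (≤-trans (s≤s (≤-reflexive (sym i≡C))) (≤-trans (≤-reflexive (sym j≡1+i)) (toℕ≤C j)))

  step⇒≤ : ∀ {i j} → Step C loop i j → toℕ i ≤ toℕ j
  step⇒≤ {i} (inj₁ j≡1+i)       = ≤-trans (n≤1+n (toℕ i)) (≤-reflexive (sym j≡1+i))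
  step⇒≤ (inj₂ (_ , i≡C , j≡C)) = ≤-reflexive (trans i≡C (sym j≡C))

  star⇒≤ : ∀ {i j} → Star (Step C loop) i j → toℕ i ≤ toℕ j
  star⇒≤ ε        = ≤-refl
  star⇒≤ (s ◅ ss) = ≤-trans (step⇒≤ s) (star⇒≤ ss)

  private
    distance⇒star : ∀ d (i j : Node) → d + toℕ i ≡ toℕ j → Star (Step C loop) i j
    distance⇒star zero i j eq with toℕ-injective eq
    ... | refl = ε
    distance⇒star (suc d) i j eq
      with successor i (≤-trans (≤-trans (s≤s (m≤n+m (toℕ i) d)) (≤-reflexive eq)) (toℕ≤C j))
    ... | k , k≡1+i = inj₁ k≡1+i ◅ distance⇒star d k j (trans (cong (d +_) k≡1+i) (trans (+-suc d (toℕ i)) eq))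

  ≤⇒star : ∀ {i j : Node} → toℕ i ≤ toℕ j → Star (Step C loop) i j
  ≤⇒star {i} {j} i≤j = distance⇒star (toℕ j ∸ toℕ i) i j (m∸n+n≡m i≤j)

  Later : Node → Node → Set
  Later i j = toℕ i < toℕ j ⊎ AtLoop C loop i j

  trans⇒later : ∀ {i j} → Trans.TransClosure (Step C loop) i j → Later i j
  trans⇒later Trans.[ inj₁ j≡1+i ] = inj₁ (≤-reflexive (sym j≡1+i))
  trans⇒later Trans.[ inj₂ atLoop ] = inj₂ atLoop
  trans⇒later (s Trans.∷ ss) with s | trans⇒later ss
  ... | inj₁ k≡1+i | inj₁ k<j = inj₁ (≤-trans (≤-reflexive (sym k≡1+i)) (<⇒≤ k<j))
  ... | inj₁ k≡1+i | inj₂ (_ , k≡C , j≡C) = inj₁ (≤-trans (≤-reflexive (sym k≡1+i)) (≤-reflexive (trans k≡C (sym j≡C))))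
  ... | inj₂ (_ , _ , k≡C) | inj₁ k<j = ⊥-elim (<-irrefl refl (≤-trans (s≤s (≤-reflexive (sym k≡C))) (≤-trans k<j (toℕ≤C _))))
  ... | inj₂ (lp , i≡C , _) | inj₂ (_ , _ , j≡C) = inj₂ (lp , i≡C , j≡C)

  later⇒trans : ∀ {i j} → Later i j → Trans.TransClosure (Step C loop) i j
  later⇒trans {i} {j} (inj₁ i<j) with successor i (≤-trans i<j (toℕ≤C j))
  ... | k , k≡1+i = step◅star (inj₁ k≡1+i) (≤⇒star (≤-trans (≤-reflexive k≡1+i) i<j))
    where
    step◅star : ∀ {i k j} → Step C loop i k → Star (Step C loop) k j → Trans.TransClosure (Step C loop) i j
    step◅star s ε        = Trans.[ s ]
    step◅star s (t ◅ ts) = s Trans.∷ step◅star t ts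
  later⇒trans (inj₂ atLoop) = Trans.[ inj₂ atLoop ]

  step? : ∀ i j → Dec (Step C loop i j)
  step? i j = (toℕ j ≟ suc (toℕ i)) ⊎-dec (IsTrue? loop ×-dec ((toℕ i ≟ C) ×-dec (toℕ j ≟ C)))

  closure? : ∀ L i j → Dec (closeFor L (lassoFrame C loop) i j)
  closure? K  i j = step? i j
  closure? T  i j = map′ [ (λ { refl → Refl.refl }) , Refl.[_] ] refl-or-step ((i Fin.≟ j) ⊎-dec step? i j)
    where
    refl-or-step : Refl.ReflClosure (Step C loop) i j → i ≡ j ⊎ Step C loop i j
    refl-or-step Refl.refl   = inj₁ refl
    refl-or-step Refl.[ s ] = inj₂ s
  closure? K4 i j =
    map′ later⇒trans trans⇒later ((toℕ i <? toℕ j) ⊎-dec (IsTrue? loop ×-dec ((toℕ i ≟ C) ×-dec (toℕ j ≟ C))))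
  closure? S4 i j = map′ ≤⇒star star⇒≤ (toℕ i ≤? toℕ j)

  isPreLinear : IsPreLinear (lassoFrame C loop)
  isPreLinear = (fzero , (λ _ → ≤⇒star z≤n) , (λ w root → toℕ-injective (n≤0⇒n≡0 (star⇒≤ (root fzero))))) , functional
    where
    functional : ∀ w u v → Step C loop w u → Step C loop w v → u ≡ v
    functional w u v (inj₁ u≡1+w)       (inj₁ v≡1+w)       = toℕ-injective (trans u≡1+w (sym v≡1+w))
    functional w u v (inj₁ u≡1+w)       (inj₂ (_ , w≡C , _)) = ⊥-elim (no-successor-at-end w u w≡C u≡1+w)
    functional w u v (inj₂ (_ , w≡C , _)) (inj₁ v≡1+w)       = ⊥-elim (no-successor-at-end w v w≡C v≡1+w)
    functional w u v (inj₂ (_ , _ , u≡C)) (inj₂ (_ , _ , v≡C)) = toℕ-injective (trans u≡C (sym v≡C))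

module Decide (N : Model)
  (universal? : (P : W (frame N) → Set) → (∀ w → Dec (P w)) → Dec (∀ w → P w))
  (R? : ∀ w v → Dec (R (frame N) w v)) (V? : ∀ w p → Dec (V N w p)) where

  ⊨? : ∀ φ w → Dec (N , w ⊨ φ)
  ⊨? (var p)  w = V? w p
  ⊨? ⊤'       w = yes tt
  ⊨? ⊥'       w = no λ ()
  ⊨? (¬' φ)   w = ¬? (⊨? φ w)
  ⊨? (φ ∧' ψ) w = ⊨? φ w ×-dec ⊨? ψ w
  ⊨? (φ ∨' ψ) w = ⊨? φ w ⊎-dec ⊨? ψ w
  ⊨? (□ φ)    w = universal? _ λ v → R? w v →-dec ⊨? φ v

lasso-⊨? : ∀ L {n C} loop (t : Table n C) φ i → Dec (closeModel L (lasso loop t) , i ⊨ φ)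
lasso-⊨? L {C = C} loop t = Decide.⊨? (closeModel L (lasso loop t)) (λ _ → all?) (Lasso.closure? C loop L)
  (λ i p → IsTrue? (bit (lookup t i) p))

Faithful : (M : Model) → W (frame M) → ∀ {n C} → Table n C → Set
Faithful M w {n} {C} t =
  ∀ (i : Fin (suc C)) p → p < n → IsTrue (bit (lookup t i) p) ⇔ M , w ⊨ □^ (toℕ i) (var p)

module CanonicalChain (M : Model) (w : W (frame M)) {n C : ℕ} (loop : Bool) (t : Table n C)
                 (faithful : Faithful M w t) where
  open Boxes M
  open Lasso C loop

  N : Logic → Model
  N L = closeModel L (lasso loop t)

  Agrees : Logic → BoxLit → Node → Set
  Agrees L l i = N L , i ⊨ ⌜ l ⌝ₗ ⇔ M , w ⊨ □^ (toℕ i) ⌜ l ⌝ₗ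

  agree-top : ∀ L i → Agrees L top i
  agree-top L i = mk⇔ (λ _ → □^-⊤ (toℕ i) w) (λ _ → tt)

  private
    fits⇒< : ∀ {m d} → m + suc d ≤ C → m < C
    fits⇒< {m} {d} fits = ≤-trans (s≤s (m≤m+n m d)) (≤-trans (≤-reflexive (sym (+-suc m d))) fits)

    fits-next : ∀ {v m d} → v ≡ suc m → m + suc d ≤ C → v + d ≤ C
    fits-next {m = m} {d} refl fits = ≤-trans (≤-reflexive (sym (+-suc m d))) fits

    ¬fits-at-end : ∀ {m d} → m ≡ C → m + suc d ≤ C → ⊥
    ¬fits-at-end refl fits = <-irrefl refl (fits⇒< fits)

  agreeK : (¬ IsTrue loop → M , w ⊨ □^ (suc C) ⊥') →
    ∀ l i → LettersBelow n l → (IsTrue loop → toℕ i + boxes l ≤ C) → Agrees K l i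
  agreeK dies top     i _   _    = agree-top K i
  agreeK dies (lit p) i p<n _    = faithful i p p<n
  agreeK dies (box l) i ls  fits = mk⇔ forth back
    where
    IH : ∀ v → toℕ v ≡ suc (toℕ i) → Agrees K l v
    IH v v≡1+i = agreeK dies l v ls (λ lp → fits-next v≡1+i (fits lp))
    forth : N K , i ⊨ ⌜ box l ⌝ₗ → M , w ⊨ □^ (toℕ i) ⌜ box l ⌝ₗ
    forth h with suc (toℕ i) ≤? C
    ... | yes i<C = let (k , k≡1+i) = successor i i<C in
      □^-unfold (toℕ i) ⌜ l ⌝ₗ (⊨□^-≡ ⌜ l ⌝ₗ k≡1+i (to (IH k k≡1+i) (h k (inj₁ k≡1+i))))
    ... | no i≮C with IsTrue? loop
    ...   | yes lp  = ⊥-elim (i≮C (fits⇒< (fits lp)))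
    ...   | no ¬lp = □^-unfold (toℕ i) ⌜ l ⌝ₗ (□^-⊥-≤ ⌜ l ⌝ₗ w (s≤s (≮⇒≥ i≮C)) (dies ¬lp))
    back : M , w ⊨ □^ (toℕ i) ⌜ box l ⌝ₗ → N K , i ⊨ ⌜ box l ⌝ₗ
    back g v (inj₁ v≡1+i)         = from (IH v v≡1+i) (⊨□^-≡ ⌜ l ⌝ₗ (sym v≡1+i) (□^-fold (toℕ i) ⌜ l ⌝ₗ g))
    back g v (inj₂ (lp , i≡C , _)) = ⊥-elim (¬fits-at-end i≡C (fits lp))

  agreeT : IsReflexive (frame M) →
    ∀ l i → LettersBelow n l → toℕ i + boxes l ≤ C → Agrees T l i
  agreeT reflexive top     i _   _    = agree-top T i
  agreeT reflexive (lit p) i p<n _    = faithful i p p<n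
  agreeT reflexive (box l) i ls  fits = mk⇔ forth back
    where
    IH : ∀ v → toℕ v ≡ suc (toℕ i) → Agrees T l v
    IH v v≡1+i = agreeT reflexive l v ls (fits-next v≡1+i fits)
    forth : N T , i ⊨ ⌜ box l ⌝ₗ → M , w ⊨ □^ (toℕ i) ⌜ box l ⌝ₗ
    forth h = let (k , k≡1+i) = successor i (fits⇒< fits) in
      □^-unfold (toℕ i) ⌜ l ⌝ₗ (⊨□^-≡ ⌜ l ⌝ₗ k≡1+i (to (IH k k≡1+i) (h k Refl.[ inj₁ k≡1+i ])))
    back : M , w ⊨ □^ (toℕ i) ⌜ box l ⌝ₗ → N T , i ⊨ ⌜ box l ⌝ₗ
    back g .i Refl.refl =
      from (agreeT reflexive l i ls (≤-trans (+-monoʳ-≤ (toℕ i) (n≤1+n (boxes l))) fits))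
           (□^-antitone reflexive {toℕ i} ⌜ l ⌝ₗ w (n≤1+n _) (□^-fold (toℕ i) ⌜ l ⌝ₗ g))
    back g v Refl.[ inj₁ v≡1+i ] = from (IH v v≡1+i) (⊨□^-≡ ⌜ l ⌝ₗ (sym v≡1+i) (□^-fold (toℕ i) ⌜ l ⌝ₗ g))
    back g v Refl.[ inj₂ (_ , i≡C , _) ] = ⊥-elim (¬fits-at-end i≡C fits)

  -- With the loop, node C stands for every depth ≥ C, which is sound once literals are stable there.
  agreeK4 : IsTransitive (frame M) → (B : ℕ) →
    (IsTrue loop → ∀ l → LettersBelow n l → boxes l < B →
       M , w ⊨ □^ (suc C) ⌜ l ⌝ₗ → M , w ⊨ □^ C ⌜ l ⌝ₗ) →
    (IsTrue loop → 1 ≤ C) → (¬ IsTrue loop → M , w ⊨ □^ (suc C) ⊥') →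
    ∀ l i → LettersBelow n l → boxes l ≤ B → Agrees K4 l i
  agreeK4 transitive B stable 1≤C dies top     i _   _ = agree-top K4 i
  agreeK4 transitive B stable 1≤C dies (lit p) i p<n _ = faithful i p p<n
  agreeK4 transitive B stable 1≤C dies (box l) i ls 1+l≤B = mk⇔ forth back
    where
    IH : ∀ v → Agrees K4 l v
    IH v = agreeK4 transitive B stable 1≤C dies l v ls (<⇒≤ 1+l≤B)
    forth : N K4 , i ⊨ ⌜ box l ⌝ₗ → M , w ⊨ □^ (toℕ i) ⌜ box l ⌝ₗ
    forth h with suc (toℕ i) ≤? C
    ... | yes i<C = let (k , k≡1+i) = successor i i<C in
      □^-unfold (toℕ i) ⌜ l ⌝ₗ (⊨□^-≡ ⌜ l ⌝ₗ k≡1+i (to (IH k) (h k Trans.[ inj₁ k≡1+i ])))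
    ... | no i≮C with IsTrue? loop
    ...   | yes lp = □^-unfold (toℕ i) ⌜ l ⌝ₗ
              (□^-monotone transitive ⌜ l ⌝ₗ w (≤-trans (1≤C lp) (≤-reflexive (sym i≡C))) (n≤1+n _)
                 (to (IH i) (h i Trans.[ inj₂ (lp , i≡C , i≡C) ])))
      where
      i≡C : toℕ i ≡ C
      i≡C = ≤-antisym (toℕ≤C i) (≮⇒≥ i≮C)
    ...   | no ¬lp = □^-unfold (toℕ i) ⌜ l ⌝ₗ (□^-⊥-≤ ⌜ l ⌝ₗ w (s≤s (≮⇒≥ i≮C)) (dies ¬lp))
    back : M , w ⊨ □^ (toℕ i) ⌜ box l ⌝ₗ → N K4 , i ⊨ ⌜ box l ⌝ₗ
    back g v i→v with trans⇒later i→v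
    ... | inj₁ i<v = from (IH v) (□^-monotone transitive ⌜ l ⌝ₗ w (s≤s z≤n) i<v (□^-fold (toℕ i) ⌜ l ⌝ₗ g))
    ... | inj₂ (lp , i≡C , v≡C) = from (IH v) (⊨□^-≡ ⌜ l ⌝ₗ (sym v≡C)
            (stable lp l ls 1+l≤B (⊨□^-≡ ⌜ l ⌝ₗ (cong suc i≡C) (□^-fold (toℕ i) ⌜ l ⌝ₗ g))))

  agreeS4 : IsReflexive (frame M) → IsTransitive (frame M) → 1 ≤ C →
    ∀ l i → LettersBelow n l → Agrees S4 l i
  agreeS4 reflexive transitive 1≤C top     i _   = agree-top S4 i
  agreeS4 reflexive transitive 1≤C (lit p) i p<n = faithful i p p<n
  agreeS4 reflexive transitive 1≤C (box l) i ls  = mk⇔ forth back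
    where
    IH : ∀ v → Agrees S4 l v
    IH v = agreeS4 reflexive transitive 1≤C l v ls
    forth : N S4 , i ⊨ ⌜ box l ⌝ₗ → M , w ⊨ □^ (toℕ i) ⌜ box l ⌝ₗ
    forth h = □^-unfold (toℕ i) ⌜ l ⌝ₗ (□^-from-positive reflexive transitive {C} {suc (toℕ i)} ⌜ l ⌝ₗ w 1≤C
      (⊨□^-≡ ⌜ l ⌝ₗ (toℕ-fromℕ C) (to (IH (fromℕ C)) (h (fromℕ C) (≤⇒star i≤last)))))
      where
      i≤last : toℕ i ≤ toℕ (fromℕ C)
      i≤last = ≤-trans (toℕ≤C i) (≤-reflexive (sym (toℕ-fromℕ C)))
    back : M , w ⊨ □^ (toℕ i) ⌜ box l ⌝ₗ → N S4 , i ⊨ ⌜ box l ⌝ₗ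
    back g v _ = from (IH v)
      (□^-from-positive reflexive transitive {suc (toℕ i)} {toℕ v} ⌜ l ⌝ₗ w (s≤s z≤n) (□^-fold (toℕ i) ⌜ l ⌝ₗ g))

  body-at : ∀ L {s} (a : Node) ls pos → All (LiteralBounded s n) ls → MaybeAll.All (LiteralBounded s n) pos →
    (∀ l → LiteralBounded s n l → Agrees L l a) → ¬ (M , w ⊨ □^ (toℕ a) ⊥') →
    M , w ⊨ □^ (toℕ a) (body ls pos) → N L , a ⊨ body ls pos
  body-at L a ls pos bls bpos agree =
    horn-transfer _ (toℕ a) ls pos bls bpos (λ l → lasso-⊨? L loop t ⌜ l ⌝ₗ a) agree

  preserveK : (¬ IsTrue loop → M , w ⊨ □^ (suc C) ⊥') → ¬ (M , w ⊨ □^ C ⊥') → (IsTrue loop → n ≤ C) →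
    ∀ c → ClauseBounded n c → M , w ⊨ ⌜ c ⌝c → N K , fzero ⊨ ⌜ c ⌝c
  preserveK dies alive n≤C (clause s ls pos) (s≤n , bls , bpos) h =
    □^-intro (N K) (λ a r → toℕ a + r ≡ s) base step s fzero refl
    where
    base : ∀ a → toℕ a + 0 ≡ s → N K , a ⊨ body ls pos
    base a a+0≡s = body-at K a ls pos bls bpos
      (λ l (fits , below) →
        agreeK dies l a below (λ lp → ≤-trans (≤-reflexive (cong (_+ boxes l) a≡s)) (≤-trans fits (n≤C lp))))
      (λ a⊥ → alive (□^-⊥-≤ ⊥' w (toℕ≤C a) a⊥))
      (⊨□^-≡ (body ls pos) (sym a≡s) h)
      where
      a≡s : toℕ a ≡ s
      a≡s = trans (sym (+-identityʳ _)) a+0≡s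
    step : ∀ {a r v} → toℕ a + suc r ≡ s → Step C loop a v → toℕ v + r ≡ s
    step {a} {r} a+1+r≡s (inj₁ v≡1+a) = trans (cong (_+ r) v≡1+a) (trans (sym (+-suc (toℕ a) r)) a+1+r≡s)
    step a+1+r≡s (inj₂ (lp , a≡C , _)) =
      ⊥-elim (¬fits-at-end a≡C (≤-trans (≤-reflexive a+1+r≡s) (≤-trans s≤n (n≤C lp))))

  preserveT : IsReflexive (frame M) → n ≤ C →
    ∀ c → ClauseBounded n c → M , w ⊨ ⌜ c ⌝c → N T , fzero ⊨ ⌜ c ⌝c
  preserveT reflexive n≤C (clause s ls pos) (_ , bls , bpos) h =
    □^-intro (N T) (λ a r → toℕ a + r ≤ s) base step s fzero ≤-refl
    where
    base : ∀ a → toℕ a + 0 ≤ s → N T , a ⊨ body ls pos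
    base a a+0≤s = body-at T a ls pos bls bpos
      (λ l (fits , below) → agreeT reflexive l a below (≤-trans (+-monoˡ-≤ (boxes l) a≤s) (≤-trans fits n≤C)))
      (¬□^⊥ reflexive (toℕ a) w)
      (□^-antitone reflexive (body ls pos) w a≤s h)
      where
      a≤s : toℕ a ≤ s
      a≤s = subst (_≤ s) (+-identityʳ _) a+0≤s
    step : ∀ {a r v} → toℕ a + suc r ≤ s → Refl.ReflClosure (Step C loop) a v → toℕ v + r ≤ s
    step {a} {r} a+1+r≤s Refl.refl = ≤-trans (+-monoʳ-≤ (toℕ a) (n≤1+n r)) a+1+r≤s
    step {a} {r} a+1+r≤s Refl.[ inj₁ v≡1+a ] =
      ≤-trans (≤-reflexive (trans (cong (_+ r) v≡1+a) (sym (+-suc (toℕ a) r)))) a+1+r≤s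
    step {a} {r} a+1+r≤s Refl.[ inj₂ (_ , a≡C , v≡C) ] =
      ≤-trans (≤-reflexive (cong (_+ r) (trans v≡C (sym a≡C)))) (≤-trans (+-monoʳ-≤ (toℕ a) (n≤1+n r)) a+1+r≤s)

  module _ (transitive : IsTransitive (frame M))
           (stable : IsTrue loop → ∀ l → LettersBelow n l → boxes l < n →
                       M , w ⊨ □^ (suc C) ⌜ l ⌝ₗ → M , w ⊨ □^ C ⌜ l ⌝ₗ)
           (1≤C : IsTrue loop → 1 ≤ C) (dies : ¬ IsTrue loop → M , w ⊨ □^ (suc C) ⊥')
           (alive : ¬ (M , w ⊨ □^ C ⊥')) (n≤C : IsTrue loop → n ≤ C) where

    private
      agree : ∀ {s a} l → LiteralBounded s n l → Agrees K4 l a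
      agree {s} {a} l (fits , below) = agreeK4 transitive n stable 1≤C dies l a below (m+n≤o⇒n≤o s fits)

    preserveK4 : ∀ c → ClauseBounded n c → M , w ⊨ ⌜ c ⌝c → N K4 , fzero ⊨ ⌜ c ⌝c
    preserveK4 (clause zero ls pos) (_ , bls , bpos) h =
      body-at K4 fzero ls pos bls bpos agree (λ 0⊥ → alive (□^-⊥-≤ {0} {C} ⊥' w z≤n 0⊥)) h
    preserveK4 (clause (suc s) ls pos) (s≤n , bls , bpos) h =
      □^-intro (N K4) (λ a r → suc s ≤ toℕ a + r) base step (suc s) fzero ≤-refl
      where
      base : ∀ a → suc s ≤ toℕ a + 0 → N K4 , a ⊨ body ls pos
      base a s≤a+0 = body-at K4 a ls pos bls bpos agree
        (λ a⊥ → alive (□^-⊥-≤ ⊥' w (toℕ≤C a) a⊥))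
        (□^-monotone transitive (body ls pos) w (s≤s z≤n) (subst (suc s ≤_) (+-identityʳ _) s≤a+0) h)
      step : ∀ {a r v} → suc s ≤ toℕ a + suc r → Trans.TransClosure (Step C loop) a v → suc s ≤ toℕ v + r
      step {a} {r} s≤a+1+r a→v with trans⇒later a→v
      ... | inj₁ a<v = ≤-trans s≤a+1+r (≤-trans (≤-reflexive (+-suc (toℕ a) r)) (+-monoˡ-≤ r a<v))
      ... | inj₂ (lp , _ , v≡C) = ≤-trans s≤n (≤-trans (n≤C lp) (≤-trans (≤-reflexive (sym v≡C)) (m≤m+n _ r)))

  module _ (reflexive : IsReflexive (frame M)) (transitive : IsTransitive (frame M)) (1≤C : 1 ≤ C) where

    private
      agree : ∀ {s a} l → LiteralBounded s n l → Agrees S4 l a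
      agree {a = a} l (_ , below) = agreeS4 reflexive transitive 1≤C l a below

    preserveS4 : ∀ c → ClauseBounded n c → M , w ⊨ ⌜ c ⌝c → N S4 , fzero ⊨ ⌜ c ⌝c
    preserveS4 (clause zero ls pos) (_ , bls , bpos) h =
      body-at S4 fzero ls pos bls bpos agree (¬□^⊥ reflexive 0 w) h
    preserveS4 (clause (suc s) ls pos) (_ , bls , bpos) h =
      □^-intro (N S4) (λ _ _ → ⊤) base (λ _ _ → tt) (suc s) fzero tt
      where
      base : ∀ a → ⊤ → N S4 , a ⊨ body ls pos
      base a _ = body-at S4 a ls pos bls bpos agree (¬□^⊥ reflexive (toℕ a) w)
        (□^-from-positive reflexive transitive {suc s} {toℕ a} (body ls pos) w (s≤s z≤n) h)

extend-below : ∀ {S : ℕ → Set} {P} → (∀ q → q < P → S q) → S P → ∀ q → q < suc P → S q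
extend-below below at q q<1+P with m<1+n⇒m<n∨m≡n q<1+P
... | inj₁ q<P  = below q q<P
... | inj₂ refl = at

core-cases : ∀ {n} l → LettersBelow n l → core l ≡ ⊤' ⊎ ∃ λ q → q < n × core l ≡ var q
core-cases top     _   = inj₁ refl
core-cases (lit p) p<n = inj₂ (p , p<n , refl)
core-cases (box l) ls  = core-cases l ls

window-bound : ℕ → ℕ → ℕ → ℕ
window-bound B X zero    = X
window-bound B X (suc P) = window-bound B (suc (window-bound B X P + B)) P

window-bound-mono : ∀ B P {X X′} → X ≤ X′ → window-bound B X P ≤ window-bound B X′ P
window-bound-mono B zero    X≤X′ = X≤X′
window-bound-mono B (suc P) X≤X′ = window-bound-mono B P (s≤s (+-monoˡ-≤ B (window-bound-mono B P X≤X′)))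

≤-window-bound : ∀ B P X → X ≤ window-bound B X P
window-bound-≤-suc : ∀ B P X → window-bound B X P ≤ window-bound B X (suc P)

≤-window-bound B zero    X = ≤-refl
≤-window-bound B (suc P) X = ≤-trans (≤-window-bound B P X) (window-bound-≤-suc B P X)

window-bound-≤-suc B P X = ≤-trans (≤-trans (m≤m+n _ B) (n≤1+n _)) (≤-window-bound B P _)

module Stabilisation (M : Model) (w : W (frame M)) (transitive : IsTransitive (frame M)) (B : ℕ) where
  open Boxes M

  StableAt : ℕ → ℕ → Set
  StableAt Y q = ∀ k → k ≤ B → M , w ⊨ □^ (suc (Y + k)) (var q) → M , w ⊨ □^ (Y + k) (var q)

  -- Being monotone in the depth from 1 on, □ᵈ q changes truth value at most once.
  ¬¬-window : ∀ P X → DoubleNegation (Σ ℕ λ Y → X ≤ Y × Y ≤ window-bound B X P × ∀ q → q < P → StableAt Y q)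
  ¬¬-window zero    X = pure (X , ≤-refl , ≤-refl , λ _ ())
  ¬¬-window (suc P) X = do
    (Y , X≤Y , Y≤bound , stable) ← ¬¬-window P X
    no unstable ← ¬¬-excluded-middle {A = StableAt Y P}
      where yes stableP → pure (Y , X≤Y , ≤-trans Y≤bound (window-bound-≤-suc B P X) , extend-below stable stableP)
    yes eventually ← ¬¬-excluded-middle {A = M , w ⊨ □^ (suc (Y + B)) (var P)}
      where no never → ⊥-elim (unstable λ k k≤B h →
                          ⊥-elim (never (□^-monotone transitive (var P) w (s≤s z≤n) (s≤s (+-monoʳ-≤ Y k≤B)) h)))
    (Y′ , Y+B<Y′ , Y′≤bound , stable′) ← ¬¬-window P (suc (Y + B))
    pure (Y′ , ≤-trans X≤Y (≤-trans (≤-trans (m≤m+n Y B) (n≤1+n _)) Y+B<Y′) ,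
          ≤-trans Y′≤bound (window-bound-mono B P (s≤s (+-monoˡ-≤ B Y≤bound))) ,
          extend-below stable′ λ k _ _ →
            □^-monotone transitive (var P) w (s≤s z≤n) (≤-trans Y+B<Y′ (m≤m+n Y′ k)) eventually)

  stable-literal : ∀ {C n} → (∀ q → q < n → StableAt C q) → ∀ l → LettersBelow n l → boxes l < B →
    M , w ⊨ □^ (suc C) ⌜ l ⌝ₗ → M , w ⊨ □^ C ⌜ l ⌝ₗ
  stable-literal {C} stable l ls l<B h = ⊨-≡ (sym (normal C)) (cases (core-cases l ls))
    where
    normal : ∀ m → □^ m ⌜ l ⌝ₗ ≡ □^ (m + boxes l) (core l)
    normal m = trans (cong (□^ m) (⌜⌝ₗ-normal l)) (□^-+ m (boxes l) (core l))
    cases : core l ≡ ⊤' ⊎ ∃ (λ q → q < _ × core l ≡ var q) → M , w ⊨ □^ (C + boxes l) (core l)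
    cases (inj₁ core≡⊤) = ⊨-≡ (cong (□^ (C + boxes l)) (sym core≡⊤)) (□^-⊤ (C + boxes l) w)
    cases (inj₂ (q , q<n , core≡q)) = ⊨-≡ (cong (□^ (C + boxes l)) (sym core≡q))
      (stable q q<n (boxes l) (<⇒≤ l<B) (⊨-≡ (trans (normal (suc C)) (cong (□^ (suc (C + boxes l))) core≡q)) h))

¬¬-lifespan : ∀ (M : Model) w N → DoubleNegation
  (¬ (M , w ⊨ □^ N ⊥') ⊎ ∃ λ D → D < N × ¬ (M , w ⊨ □^ D ⊥') × M , w ⊨ □^ (suc D) ⊥')
¬¬-lifespan M w zero    = pure (inj₁ λ ())
¬¬-lifespan M w (suc N) = do
  yes dead ← ¬¬-excluded-middle {A = M , w ⊨ □^ (suc N) ⊥'}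
    where no alive → pure (inj₁ alive)
  inj₂ (D , D<N , alive , deadD) ← ¬¬-lifespan M w N
    where inj₁ alive → pure (inj₂ (N , ≤-refl , alive , dead))
  pure (inj₂ (D , m≤n⇒m≤1+n D<N , alive , deadD))

¬¬-truth-value : (Q : Set) → DoubleNegation (Σ Bool λ b → IsTrue b ⇔ Q)
¬¬-truth-value Q = do
  q? ← ¬¬-excluded-middle {A = Q}
  pure (isYes q? , mk⇔ toWitness fromWitness)

¬¬-choice : ∀ {n} {A : Set} {S : Fin n → A → Set} →
  (∀ i → DoubleNegation (Σ A (S i))) → DoubleNegation (Σ (Vec A n) λ v → ∀ i → S i (lookup v i))
¬¬-choice {zero}  _      = pure ([] , λ ())
¬¬-choice {suc n} choose = do
  (a , sa) ← choose fzero
  (v , sv) ← ¬¬-choice (choose ∘ fsuc)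
  pure (a ∷ v , λ { fzero → sa ; (fsuc i) → sv i })

¬¬-faithful : ∀ (M : Model) w n C → DoubleNegation (Σ (Table n C) (Faithful M w))
¬¬-faithful M w n C = do
  (t , exact) ← ¬¬-choice λ i → ¬¬-choice λ j → ¬¬-truth-value (M , w ⊨ □^ (toℕ i) (var (toℕ j)))
  pure (t , λ i p p<n → faithful-at t exact i p<n)
  where
  faithful-at : ∀ t → (∀ i j → IsTrue (lookup (lookup t i) j) ⇔ M , w ⊨ □^ (toℕ i) (var (toℕ j))) →
    ∀ i {p} (p<n : p < n) → IsTrue (bit (lookup t i) p) ⇔ M , w ⊨ □^ (toℕ i) (var p)
  faithful-at t exact i p<n
    rewrite sym (toℕ-fromℕ< p<n) | bit-toℕ (lookup t i) (fromℕ< p<n) = exact i (fromℕ< p<n)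

Exhaustible : Set → Set₁
Exhaustible A = ∀ {P : A → Set} → (∀ a → Dec (P a)) → Dec (∃ P)

any-Bool? : Exhaustible Bool
any-Bool? P? = map′ (λ { (inj₁ p) → true , p ; (inj₂ p) → false , p })
                    (λ { (true , p) → inj₁ p ; (false , p) → inj₂ p })
                    (P? true ⊎-dec P? false)

any-Vec? : ∀ {A} → Exhaustible A → ∀ {n} → Exhaustible (Vec A n)
any-Vec? any? {zero}  P? = map′ (λ p → [] , p) (λ { ([] , p) → p }) (P? [])
any-Vec? any? {suc n} P? = map′ (λ { (a , v , p) → a ∷ v , p }) (λ { (a ∷ v , p) → a , v , p })
  (any? λ a → any-Vec? any? λ v → P? (a ∷ v))

Witness : Logic → HornBox → ℕ → ℕ → Set
Witness L φ n bound =
  ∃ λ C → C < bound × Σ Bool λ loop → Σ (Table n C) λ t → closeModel L (lasso loop t) , fzero ⊨ ⌜ φ ⌝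

witness? : ∀ L φ n bound → Dec (Witness L φ n bound)
witness? L φ n = anyUpTo? λ C → any-Bool? λ loop → any-Vec? (any-Vec? any-Bool?) λ t → lasso-⊨? L loop t ⌜ φ ⌝ fzero

witness⇒prelinear : ∀ {L φ n bound} → Witness L φ n bound → PreLinearSatisfiable L ⌜ φ ⌝
witness⇒prelinear (C , _ , loop , t , h) = lasso loop t , Lasso.isPreLinear C loop , fzero , h

¬¬-witness-from : ∀ L φ n bound (M : Model) w C loop → C < bound →
  (∀ (t : Table n C) → Faithful M w t → closeModel L (lasso loop t) , fzero ⊨ ⌜ φ ⌝) →
  DoubleNegation (Witness L φ n bound)
¬¬-witness-from L φ n bound M w C loop C<bound sat = do
  (t , faithful) ← ¬¬-faithful M w n C
  pure (C , C<bound , loop , t , sat t faithful)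

chain-bound : Logic → ℕ → ℕ
chain-bound K  n = n
chain-bound T  n = n
chain-bound K4 n = window-bound n (n ⊔ 1) n
chain-bound S4 n = 1

¬¬-witness : ∀ L φ n → Bounded n φ → (M : Model) → InClass L (frame M) → ∀ w →
  M , w ⊨ ⌜ φ ⌝ → DoubleNegation (Witness L φ n (suc (chain-bound L n)))
¬¬-witness K φ n bnd M _ w h = do
  inj₁ alive ← ¬¬-lifespan M w n
    where inj₂ (D , D<n , alive , dead) →
            ¬¬-witness-from K φ n _ M w D false (m≤n⇒m≤1+n D<n) λ t faithful →
              ⌜⌝-transfer (CanonicalChain.preserveK M w false t faithful (λ _ → dead) alive λ ()) φ bnd h
  ¬¬-witness-from K φ n _ M w n true ≤-refl λ t faithful →
    ⌜⌝-transfer (CanonicalChain.preserveK M w true t faithful (λ ¬lp → ⊥-elim (¬lp tt)) alive λ _ → ≤-refl) φ bnd h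
¬¬-witness T φ n bnd M reflexive w h =
  ¬¬-witness-from T φ n _ M w n false ≤-refl λ t faithful →
    ⌜⌝-transfer (CanonicalChain.preserveT M w false t faithful reflexive ≤-refl) φ bnd h
¬¬-witness S4 φ n bnd M (reflexive , transitive) w h =
  ¬¬-witness-from S4 φ n _ M w 1 false ≤-refl λ t faithful →
    ⌜⌝-transfer (CanonicalChain.preserveS4 M w false t faithful reflexive transitive ≤-refl) φ bnd h
¬¬-witness K4 φ n bnd M transitive w h = do
  (Y , n⊔1≤Y , Y≤bound , stable) ← ¬¬-window n (n ⊔ 1)
  inj₁ alive ← ¬¬-lifespan M w Y
    where inj₂ (D , D<Y , alive , dead) →
            ¬¬-witness-from K4 φ n _ M w D false (s≤s (≤-trans (<⇒≤ D<Y) Y≤bound)) λ t faithful →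
              ⌜⌝-transfer (CanonicalChain.preserveK4 M w false t faithful transitive
                             (λ ()) (λ ()) (λ _ → dead) alive (λ ())) φ bnd h
  ¬¬-witness-from K4 φ n _ M w Y true (s≤s Y≤bound) λ t faithful →
    ⌜⌝-transfer (CanonicalChain.preserveK4 M w true t faithful transitive (λ _ → stable-literal {Y} stable)
      (λ _ → ≤-trans (m≤n⊔m n 1) n⊔1≤Y) (λ ¬lp → ⊥-elim (¬lp tt)) alive (λ _ → ≤-trans (m≤m⊔n n 1) n⊔1≤Y)) φ bnd h
  where open Stabilisation M w transitive n

closure-inClass : ∀ L M → InClass L (frame (closeModel L M))
closure-inClass K  M = tt
closure-inClass T  M = λ _ → Refl.refl
closure-inClass K4 M = λ _ _ _ → Trans._++_
closure-inClass S4 M = (λ _ → ε) , (λ _ _ _ → _◅◅_)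

lemma4p2 : (L : Logic) (φ : HornBox) →
    Satisfiable L ⌜ φ ⌝ ⇔ PreLinearSatisfiable L ⌜ φ ⌝
lemma4p2 L φ = mk⇔ satisfiable⇒prelinear prelinear⇒satisfiable
  where
  satisfiable⇒prelinear : Satisfiable L ⌜ φ ⌝ → PreLinearSatisfiable L ⌜ φ ⌝
  satisfiable⇒prelinear (M , inClass , w , h) =
    let (n , bnd) = bounded φ in
    witness⇒prelinear {L} {φ} (decidable-stable (witness? L φ n _) (¬¬-witness L φ n bnd M inClass w h))
  prelinear⇒satisfiable : PreLinearSatisfiable L ⌜ φ ⌝ → Satisfiable L ⌜ φ ⌝
  prelinear⇒satisfiable (M , _ , w , h) = closeModel L M , closure-inClass L M , w , h
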